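{- For a nonnegative integer $g$, let $\mathcal{S}(3,g)$ be the set of numerical semigroups with multiplicity three and genus $g$. Then the map $g\mapsto \#\mathcal{S}(3,g)$ is nondecreasing on the nonnegative integers.
   Context: A numerical semigroup is a submonoid $S$ of $(\mathbb{N},+)$ (so $0\in S$ and $S$ is closed under addition) with $\mathbb{N}\setminus S$ finite. Its genus is $\#(\mathbb{N}\setminus S)$, and its multiplicity is the least positive integer in $S$. -}

module Defs where

open import Data.Nat using (ℕ; zero; suc; _+_; _<_; _≤_)
open import Data.Bool using (Bool; true; false)
open import Data.Fin using (Fin)
open import Data.List using (List; length)
open import Data.List.Membership.Propositional using (_∈_)
open import Data.List.Relation.Unary.Unique.Propositional using (Unique)
open import Data.Product using (Σ; ∃; _×_; proj₁)
open import Function.Bundles using (_⇔_)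
open import Relation.Binary.PropositionalEquality using (_≡_)

record NumericalSemigroup : Set where
  field
    mem      : ℕ → Bool
    zero∈    : mem 0 ≡ true
    closed   : ∀ a b → mem a ≡ true → mem b ≡ true → mem (a + b) ≡ true
    cofinite : ∃ λ (L : List ℕ) → ∀ x → (x ∈ L) ⇔ (mem x ≡ false)
open NumericalSemigroup public

Genus : NumericalSemigroup → ℕ → Set
Genus S g = ∃ λ (L : List ℕ) →
  Unique L × length L ≡ g × (∀ x → (x ∈ L) ⇔ (mem S x ≡ false))

Multiplicity : NumericalSemigroup → ℕ → Set
Multiplicity S m =
  0 < m × mem S m ≡ true × (∀ k → 0 < k → k < m → mem S k ≡ false)

𝒮 : ℕ → ℕ → Set
𝒮 m g = Σ NumericalSemigroup λ S → Multiplicity S m × Genus S g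

_≋_ : ∀ {m g} → 𝒮 m g → 𝒮 m g → Set
s ≋ t = ∀ x → mem (proj₁ s) x ≡ mem (proj₁ t) x

HasCard : ℕ → ℕ → ℕ → Set
HasCard m g n = Σ (Fin n → 𝒮 m g) λ f →
  (∀ i j → f i ≋ f j → i ≡ j) × (∀ s → ∃ λ i → f i ≋ s)

module Submission where

-- A numerical semigroup S containing 3 is determined by two thresholds: the
-- least elements of S congruent to 1 and to 2 modulo 3 are 1 + 3a and 2 + 3b,
-- and then  1 + 3q ∈ S ⇔ a ≤ q  and  2 + 3q ∈ S ⇔ b ≤ q.  The set described
-- by such a pair (a, b) (the "Kunz semigroup" below) is closed under addition
-- exactly when  b ≤ 2a  and  a ≤ 2b + 1;  its gaps are 1 + 3q (q < a) and
-- 2 + 3q (q < b), so its genus is a + b; its multiplicity is 3 iff a, b ≥ 1.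
-- Hence 𝒮(3,g) is in bijection with the admissible pairs (a, g - a), listed
-- by `candidates g`.  Finally  a ↦ a + 1  if 3 ∣ g  and  a ↦ a  otherwise maps
-- the admissible pairs of genus g injectively to those of genus g + 1.

open import Defs
open import Data.Bool using (Bool; true; false)
open import Data.Bool.Properties using (T-≡; ¬-not; not-¬)
open import Data.Empty using (⊥-elim)
open import Data.Fin as Fin using (Fin)
open import Data.Fin.Properties using (injective⇒≤)
open import Data.List using (List; _∷_; _++_; length; lookup; map; filter; upTo)
open import Data.List.Properties using (length-map; length-++; length-upTo)
open import Data.List.Membership.Propositional using (_∈_)
open import Data.List.Membership.Propositional.Properties
  using (∈-lookup; ∈-map⁺; ∈-map⁻; ∈-++⁺ˡ; ∈-++⁺ʳ; ∈-++⁻; ∈-upTo⁺; ∈-upTo⁻; ∈-filter⁺; ∈-filter⁻)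
open import Data.List.Relation.Binary.Subset.Propositional using (_⊆_)
open import Data.List.Relation.Unary.All as All using ()
open import Data.List.Relation.Unary.AllPairs using (_∷_)
open import Data.List.Relation.Unary.Any as Any using (here; there)
open import Data.List.Relation.Unary.Any.Properties using (lookup-index)
open import Data.List.Relation.Unary.Unique.Propositional using (Unique)
import Data.List.Relation.Unary.Unique.Propositional.Properties as Unique
open import Data.Nat
open import Data.Nat.DivMod using (_%_; [m+kn]%n≡m%n; m*n%n≡0)
open import Data.Nat.ListAction using (sum)
open import Data.Nat.Properties
open import Data.Nat.Tactic.RingSolver using (solve-∀)
open import Data.Product using (∃; ∃₂; _×_; _,_; proj₁; proj₂)
open import Data.Sum using (inj₁; inj₂)
open import Function.Bundles using (_⇔_; mk⇔; Equivalence)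
open import Relation.Nullary using (Dec; ¬_; contradiction)
open import Relation.Nullary.Decidable using (_×-dec_)
open import Relation.Binary.PropositionalEquality

unique-lookup-injective : ∀ {A : Set} {xs : List A} → Unique xs →
  ∀ i j → lookup xs i ≡ lookup xs j → i ≡ j
unique-lookup-injective (_ ∷ _) Fin.zero Fin.zero _ = refl
unique-lookup-injective (x∉ ∷ _) Fin.zero (Fin.suc j) e = ⊥-elim (All.lookup x∉ (∈-lookup j) e)
unique-lookup-injective (x∉ ∷ _) (Fin.suc i) Fin.zero e = ⊥-elim (All.lookup x∉ (∈-lookup i) (sym e))
unique-lookup-injective (_ ∷ u) (Fin.suc i) (Fin.suc j) e = cong Fin.suc (unique-lookup-injective u i j e)

-- A repetition-free list contained in another list is at most as long:
-- sending each position to the position of the same entry is injective.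
unique-⊆-length : ∀ {A : Set} {xs ys : List A} → Unique xs → xs ⊆ ys →
  length xs ≤ length ys
unique-⊆-length {xs = xs} {ys} u xs⊆ys = injective⇒≤ position-injective
  where
  position : Fin (length xs) → Fin (length ys)
  position i = Any.index (xs⊆ys (∈-lookup i))

  position-injective : ∀ {i j} → position i ≡ position j → i ≡ j
  position-injective {i} {j} e = unique-lookup-injective u i j (begin
    lookup xs i            ≡⟨ lookup-index (xs⊆ys (∈-lookup i)) ⟩
    lookup ys (position i) ≡⟨ cong (lookup ys) e ⟩
    lookup ys (position j) ≡⟨ lookup-index (xs⊆ys (∈-lookup j)) ⟨
    lookup xs j            ∎)
    where open ≡-Reasoning

unique-same-length : ∀ {A : Set} {xs ys : List A} → Unique xs → Unique ys →
  (∀ x → x ∈ xs ⇔ x ∈ ys) → length xs ≡ length ys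
unique-same-length u v same = ≤-antisym
  (unique-⊆-length u λ {x} → Equivalence.to (same x))
  (unique-⊆-length v λ {x} → Equivalence.from (same x))

∈⇒≤sum : ∀ {x xs} → x ∈ xs → x ≤ sum xs
∈⇒≤sum {xs = y ∷ ys} (here refl) = m≤m+n y (sum ys)
∈⇒≤sum {xs = y ∷ ys} (there x∈ys) = ≤-trans (∈⇒≤sum x∈ys) (m≤n+m (sum ys) y)

≤ᵇ-true : ∀ {m n} → m ≤ n → (m ≤ᵇ n) ≡ true
≤ᵇ-true m≤n = Equivalence.to T-≡ (≤⇒≤ᵇ m≤n)

≤ᵇ-true⁻ : ∀ {m n} → (m ≤ᵇ n) ≡ true → m ≤ n
≤ᵇ-true⁻ {m} {n} e = ≤ᵇ⇒≤ m n (Equivalence.from T-≡ e)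

≤ᵇ-false : ∀ {m n} → n < m → (m ≤ᵇ n) ≡ false
≤ᵇ-false {m} {n} n<m = ¬-not λ e → <⇒≱ n<m (≤ᵇ-true⁻ e)

≤ᵇ-false⁻ : ∀ {m n} → (m ≤ᵇ n) ≡ false → n < m
≤ᵇ-false⁻ e = ≰⇒> λ m≤n → not-¬ (≤ᵇ-true m≤n) e

≤ᵇ-suc : ∀ m n → (suc m ≤ᵇ suc n) ≡ (m ≤ᵇ n)
≤ᵇ-suc zero    n = refl
≤ᵇ-suc (suc m) n = refl

threshold-unique : ∀ {s t} → (∀ q → (s ≤ᵇ q) ≡ (t ≤ᵇ q)) → s ≡ t
threshold-unique {s} {t} same = ≤-antisym
  (≤ᵇ-true⁻ (trans (same t) (≤ᵇ-true (≤-refl {t}))))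
  (≤ᵇ-true⁻ (trans (sym (same s)) (≤ᵇ-true (≤-refl {s}))))

UpwardClosed : (ℕ → Bool) → Set
UpwardClosed p = ∀ q → p q ≡ true → p (suc q) ≡ true

threshold : (p : ℕ → Bool) → UpwardClosed p → ∀ N → p N ≡ true →
  ∃ λ t → ∀ q → p q ≡ (t ≤ᵇ q)
threshold p up N pN with p 0 in p0
... | true = 0 , always
  where
  always : ∀ q → p q ≡ true
  always zero    = p0
  always (suc q) = up q (always q)
threshold p up zero pN | false = contradiction (trans (sym pN) p0) λ ()
threshold p up (suc N) pN | false with threshold (λ q → p (suc q)) (λ q → up (suc q)) N pN
... | t , p∘suc≡ = suc t , λ where
  zero    → p0
  (suc q) → trans (p∘suc≡ q) (sym (≤ᵇ-suc t q))

AddClosed : (ℕ → Bool) → Set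
AddClosed p = ∀ x y → p x ≡ true → p y ≡ true → p (x + y) ≡ true

multiples-in : ∀ S {m} → mem S m ≡ true → ∀ q → mem S (q * m) ≡ true
multiples-in S m∈S zero    = zero∈ S
multiples-in S m∈S (suc q) = closed S _ _ m∈S (multiples-in S m∈S q)

-- A numerical semigroup contains every number beyond the sum of its gaps.
eventually-in : ∀ S → ∃ λ N → ∀ x → N < x → mem S x ≡ true
eventually-in S with cofinite S
... | L , gap⇔ = sum L , in-S
  where
  in-S : ∀ x → sum L < x → mem S x ≡ true
  in-S x N<x with mem S x in x∈?
  ... | true  = refl
  ... | false = contradiction (∈⇒≤sum (Equivalence.from (gap⇔ x) x∈?)) (<⇒≱ N<x)

data Mod3 : ℕ → Set where
  rem0 : ∀ q → Mod3 (q * 3)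
  rem1 : ∀ q → Mod3 (1 + q * 3)
  rem2 : ∀ q → Mod3 (2 + q * 3)

mod3 : ∀ x → Mod3 x
mod3 0 = rem0 0
mod3 1 = rem1 0
mod3 2 = rem2 0
mod3 (suc (suc (suc x))) with mod3 x
... | rem0 q = rem0 (suc q)
... | rem1 q = rem1 (suc q)
... | rem2 q = rem2 (suc q)

class₁ class₂ : ℕ → ℕ
class₁ q = 1 + q * 3
class₂ q = 2 + q * 3

residue : ∀ i q → (i + q * 3) % 3 ≡ i % 3
residue i q = [m+kn]%n≡m%n i q 3

regroup : ∀ i j q r → (i + q * 3) + (j + r * 3) ≡ (i + j) + (q + r) * 3
regroup = solve-∀

add-three : ∀ i q → 3 + (i + q * 3) ≡ i + suc q * 3
add-three = solve-∀

-- Membership in the Kunz semigroup with thresholds a, b: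
-- 3q always, 1 + 3q iff a ≤ q, 2 + 3q iff b ≤ q.
kunzMem : ℕ → ℕ → ℕ → Bool
kunzMem a b 0 = true
kunzMem a b 1 = a ≤ᵇ 0
kunzMem a b 2 = b ≤ᵇ 0
kunzMem a b (suc (suc (suc x))) = kunzMem (pred a) (pred b) x

kunz₀ : ∀ a b q → kunzMem a b (q * 3) ≡ true
kunz₀ a b zero    = refl
kunz₀ a b (suc q) = kunz₀ (pred a) (pred b) q

kunz₁ : ∀ a b q → kunzMem a b (1 + q * 3) ≡ (a ≤ᵇ q)
kunz₁ a       b zero    = refl
kunz₁ zero    b (suc q) = kunz₁ zero (pred b) q
kunz₁ (suc a) b (suc q) = trans (kunz₁ a (pred b) q) (sym (≤ᵇ-suc a q))

kunz₂ : ∀ a b q → kunzMem a b (2 + q * 3) ≡ (b ≤ᵇ q)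
kunz₂ a b       zero    = refl
kunz₂ a zero    (suc q) = kunz₂ (pred a) zero q
kunz₂ a (suc b) (suc q) = trans (kunz₂ (pred a) b q) (sym (≤ᵇ-suc b q))

module Kunz (a b : ℕ) where

  in₁ : ∀ q → a ≤ q → kunzMem a b (1 + q * 3) ≡ true
  in₁ q a≤q = trans (kunz₁ a b q) (≤ᵇ-true a≤q)

  in₂ : ∀ q → b ≤ q → kunzMem a b (2 + q * 3) ≡ true
  in₂ q b≤q = trans (kunz₂ a b q) (≤ᵇ-true b≤q)

  in₁⁻ : ∀ q → kunzMem a b (1 + q * 3) ≡ true → a ≤ q
  in₁⁻ q e = ≤ᵇ-true⁻ (trans (sym (kunz₁ a b q)) e)

  in₂⁻ : ∀ q → kunzMem a b (2 + q * 3) ≡ true → b ≤ q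
  in₂⁻ q e = ≤ᵇ-true⁻ (trans (sym (kunz₂ a b q)) e)

  regrouped : ∀ i j q r → kunzMem a b ((i + j) + (q + r) * 3) ≡ true →
    kunzMem a b ((i + q * 3) + (j + r * 3)) ≡ true
  regrouped i j q r = subst (λ z → kunzMem a b z ≡ true) (sym (regroup i j q r))

  kunz-closed : b ≤ a + a → a ≤ suc (b + b) → AddClosed (kunzMem a b)
  kunz-closed b≤2a a≤2b+1 x y x∈ y∈ with mod3 x | mod3 y
  ... | rem0 q | rem0 r = regrouped 0 0 q r (kunz₀ a b (q + r))
  ... | rem0 q | rem1 r = regrouped 0 1 q r (in₁ (q + r) (≤-trans (in₁⁻ r y∈) (m≤n+m r q)))
  ... | rem0 q | rem2 r = regrouped 0 2 q r (in₂ (q + r) (≤-trans (in₂⁻ r y∈) (m≤n+m r q)))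
  ... | rem1 q | rem0 r = regrouped 1 0 q r (in₁ (q + r) (≤-trans (in₁⁻ q x∈) (m≤m+n q r)))
  ... | rem2 q | rem0 r = regrouped 2 0 q r (in₂ (q + r) (≤-trans (in₂⁻ q x∈) (m≤m+n q r)))
  ... | rem1 q | rem2 r = regrouped 1 2 q r (kunz₀ a b (suc (q + r)))
  ... | rem2 q | rem1 r = regrouped 2 1 q r (kunz₀ a b (suc (q + r)))
  ... | rem1 q | rem1 r =
    regrouped 1 1 q r (in₂ (q + r) (≤-trans b≤2a (+-mono-≤ (in₁⁻ q x∈) (in₁⁻ r y∈))))
  ... | rem2 q | rem2 r =
    regrouped 2 2 q r (in₁ (suc (q + r))
      (≤-trans a≤2b+1 (s≤s (+-mono-≤ (in₂⁻ q x∈) (in₂⁻ r y∈)))))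

  -- Conversely, closure forces Kunz's inequalities, since the doubles
  -- 2(1 + 3a) = 2 + 3(2a)  and  2(2 + 3b) = 1 + 3(2b + 1)  must be elements.
  kunz-closed⁻ : AddClosed (kunzMem a b) → b ≤ a + a × a ≤ suc (b + b)
  kunz-closed⁻ closedK =
    in₂⁻ (a + a) (doubled 1 a (in₁ a ≤-refl)) ,
    in₁⁻ (suc (b + b)) (doubled 2 b (in₂ b ≤-refl))
    where
    doubled : ∀ i q → kunzMem a b (i + q * 3) ≡ true →
      kunzMem a b ((i + i) + (q + q) * 3) ≡ true
    doubled i q e =
      subst (λ z → kunzMem a b z ≡ true) (regroup i i q q) (closedK (i + q * 3) (i + q * 3) e e)

  gaps : List ℕ
  gaps = map class₁ (upTo a) ++ map class₂ (upTo b)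

  gaps-length : length gaps ≡ a + b
  gaps-length = begin
    length gaps
      ≡⟨ length-++ (map class₁ (upTo a)) ⟩
    length (map class₁ (upTo a)) + length (map class₂ (upTo b))
      ≡⟨ cong₂ _+_ (length-map class₁ (upTo a)) (length-map class₂ (upTo b)) ⟩
    length (upTo a) + length (upTo b)
      ≡⟨ cong₂ _+_ (length-upTo a) (length-upTo b) ⟩
    a + b ∎
    where open ≡-Reasoning

  gaps-unique : Unique gaps
  gaps-unique = Unique.++⁺ (Unique.map⁺ class₁-injective (Unique.upTo⁺ a))
                           (Unique.map⁺ class₂-injective (Unique.upTo⁺ b)) disjoint
    where
    class₁-injective : ∀ {q r} → class₁ q ≡ class₁ r → q ≡ r
    class₁-injective {q} {r} e = *-cancelʳ-≡ q r 3 (suc-injective e)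

    class₂-injective : ∀ {q r} → class₂ q ≡ class₂ r → q ≡ r
    class₂-injective {q} {r} e = *-cancelʳ-≡ q r 3 (suc-injective (suc-injective e))

    disjoint : ∀ {x} → ¬ (x ∈ map class₁ (upTo a) × x ∈ map class₂ (upTo b))
    disjoint (x∈₁ , x∈₂) with ∈-map⁻ class₁ x∈₁ | ∈-map⁻ class₂ x∈₂
    ... | q , _ , refl | r , _ , e =
      contradiction (trans (sym (residue 1 q)) (trans (cong (_% 3) e) (residue 2 r))) λ ()

  gaps-spec : ∀ x → x ∈ gaps ⇔ kunzMem a b x ≡ false
  gaps-spec x = mk⇔ gap⇒out out⇒gap
    where
    gap⇒out : x ∈ gaps → kunzMem a b x ≡ false
    gap⇒out x∈ with ∈-++⁻ (map class₁ (upTo a)) x∈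
    ... | inj₁ x∈₁ with ∈-map⁻ class₁ x∈₁
    ...   | q , q<a , refl = trans (kunz₁ a b q) (≤ᵇ-false (∈-upTo⁻ q<a))
    gap⇒out x∈ | inj₂ x∈₂ with ∈-map⁻ class₂ x∈₂
    ...   | q , q<b , refl = trans (kunz₂ a b q) (≤ᵇ-false (∈-upTo⁻ q<b))

    out⇒gap : kunzMem a b x ≡ false → x ∈ gaps
    out⇒gap x∉ with mod3 x
    ... | rem0 q = contradiction (trans (sym (kunz₀ a b q)) x∉) λ ()
    ... | rem1 q = ∈-++⁺ˡ (∈-map⁺ class₁
                     (∈-upTo⁺ (≤ᵇ-false⁻ {a} {q} (trans (sym (kunz₁ a b q)) x∉))))
    ... | rem2 q = ∈-++⁺ʳ (map class₁ (upTo a)) (∈-map⁺ class₂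
                     (∈-upTo⁺ (≤ᵇ-false⁻ {b} {q} (trans (sym (kunz₂ a b q)) x∉))))

Admissible : ℕ → ℕ → Set
Admissible a b = 1 ≤ a × 1 ≤ b × b ≤ a + a × a ≤ suc (b + b)

admissible? : ∀ a b → Dec (Admissible a b)
admissible? a b = 1 ≤? a ×-dec 1 ≤? b ×-dec b ≤? a + a ×-dec a ≤? suc (b + b)

kunzSemigroup : ∀ a b → b ≤ a + a → a ≤ suc (b + b) → NumericalSemigroup
kunzSemigroup a b b≤2a a≤2b+1 = record
  { mem      = kunzMem a b
  ; zero∈    = refl
  ; closed   = Kunz.kunz-closed a b b≤2a a≤2b+1
  ; cofinite = Kunz.gaps a b , Kunz.gaps-spec a b
  }

kunz-multiplicity : ∀ {a b} (b≤2a : b ≤ a + a) (a≤2b+1 : a ≤ suc (b + b)) →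
  1 ≤ a → 1 ≤ b → Multiplicity (kunzSemigroup a b b≤2a a≤2b+1) 3
kunz-multiplicity _ _ (s≤s z≤n) (s≤s z≤n) = s≤s z≤n , refl , below3
  where
  below3 : ∀ {a b} k → 0 < k → k < 3 → kunzMem (suc a) (suc b) k ≡ false
  below3 1 _ _ = refl
  below3 2 _ _ = refl
  below3 (suc (suc (suc k))) _ (s≤s (s≤s (s≤s ())))

kunzElement : ∀ {g a b} → a + b ≡ g → Admissible a b → 𝒮 3 g
kunzElement {a = a} {b} a+b≡g (a≥1 , b≥1 , b≤2a , a≤2b+1) =
  kunzSemigroup a b b≤2a a≤2b+1 ,
  kunz-multiplicity b≤2a a≤2b+1 a≥1 b≥1 ,
  (Kunz.gaps a b , Kunz.gaps-unique a b ,
   trans (Kunz.gaps-length a b) a+b≡g , Kunz.gaps-spec a b)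

-- In a numerical semigroup containing 3, each residue class modulo 3 meets
-- the semigroup in a threshold set  {i + 3q | t ≤ q}:  it is closed under
-- adding 3, and contains the large numbers.
residue-class-threshold : ∀ S → mem S 3 ≡ true → ∀ i →
  ∃ λ t → ∀ q → mem S (i + q * 3) ≡ (t ≤ᵇ q)
residue-class-threshold S 3∈S i with eventually-in S
... | N , large = threshold (λ q → mem S (i + q * 3)) up (suc N) (large _ N<)
  where
  up : UpwardClosed (λ q → mem S (i + q * 3))
  up q e = subst (λ z → mem S z ≡ true) (add-three i q) (closed S 3 _ 3∈S e)

  N< : N < i + suc N * 3
  N< = ≤-trans (m≤m*n (suc N) 3) (m≤n+m (suc N * 3) i)

classify : ∀ {g} (s : 𝒮 3 g) → ∃₂ λ a b →
  a + b ≡ g × Admissible a b × (∀ x → mem (proj₁ s) x ≡ kunzMem a b x)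
classify {g} (S , (_ , 3∈S , below3) , (L , L-unique , L-length , L-spec)) =
  a , b , a+b≡g , (a≥1 , b≥1 , kunz-inequalities) , agree
  where
  a b : ℕ
  a = proj₁ (residue-class-threshold S 3∈S 1)
  b = proj₁ (residue-class-threshold S 3∈S 2)

  agree : ∀ x → mem S x ≡ kunzMem a b x
  agree x with mod3 x
  ... | rem0 q = trans (multiples-in S 3∈S q) (sym (kunz₀ a b q))
  ... | rem1 q = trans (proj₂ (residue-class-threshold S 3∈S 1) q) (sym (kunz₁ a b q))
  ... | rem2 q = trans (proj₂ (residue-class-threshold S 3∈S 2) q) (sym (kunz₂ a b q))

  a≥1 : 1 ≤ a
  a≥1 = ≤ᵇ-false⁻ {a} {0} (trans (sym (agree 1)) (below3 1 (s≤s z≤n) (s≤s (s≤s z≤n))))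

  b≥1 : 1 ≤ b
  b≥1 = ≤ᵇ-false⁻ {b} {0} (trans (sym (agree 2)) (below3 2 (s≤s z≤n) (s≤s (s≤s (s≤s z≤n)))))

  kunz-inequalities : b ≤ a + a × a ≤ suc (b + b)
  kunz-inequalities = Kunz.kunz-closed⁻ a b λ x y x∈ y∈ →
    trans (sym (agree (x + y))) (closed S x y (trans (agree x) x∈) (trans (agree y) y∈))

  -- the gaps of S and of the Kunz semigroup coincide, so the genus is a + b
  same-gaps : ∀ x → x ∈ Kunz.gaps a b ⇔ x ∈ L
  same-gaps x = mk⇔
    (λ x∈ → Equivalence.from (L-spec x)
              (trans (agree x) (Equivalence.to (Kunz.gaps-spec a b x) x∈)))
    (λ x∈ → Equivalence.from (Kunz.gaps-spec a b x)
              (trans (sym (agree x)) (Equivalence.to (L-spec x) x∈)))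

  a+b≡g : a + b ≡ g
  a+b≡g = trans (sym (Kunz.gaps-length a b))
    (trans (unique-same-length (Kunz.gaps-unique a b) L-unique same-gaps) L-length)

candidates : ℕ → List ℕ
candidates g = filter (λ a → admissible? a (g ∸ a)) (upTo g)

candidates-unique : ∀ g → Unique (candidates g)
candidates-unique g = Unique.filter⁺ (λ a → admissible? a (g ∸ a)) (Unique.upTo⁺ g)

candidate⁺ : ∀ {g a b} → a + b ≡ g → Admissible a b → a ∈ candidates g
candidate⁺ {a = a} {b} refl adm@(_ , b≥1 , _) =
  ∈-filter⁺ (λ a′ → admissible? a′ (a + b ∸ a′)) (∈-upTo⁺ (m<m+n a b≥1))
    (subst (Admissible a) (sym (m+n∸m≡n a b)) adm)

candidate⁻ : ∀ {g a} → a ∈ candidates g → a + (g ∸ a) ≡ g × Admissible a (g ∸ a)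
candidate⁻ {g} a∈ with ∈-filter⁻ (λ a′ → admissible? a′ (g ∸ a′)) {xs = upTo g} a∈
... | a<g , adm = m+[n∸m]≡n (<⇒≤ (∈-upTo⁻ a<g)) , adm

enumerate : ∀ g → Fin (length (candidates g)) → 𝒮 3 g
enumerate g i = kunzElement (proj₁ pair) (proj₂ pair)
  where
  pair : lookup (candidates g) i + (g ∸ lookup (candidates g) i) ≡ g ×
         Admissible (lookup (candidates g) i) (g ∸ lookup (candidates g) i)
  pair = candidate⁻ (∈-lookup i)

enumerated : ∀ g {a b} (s : 𝒮 3 g) → a + b ≡ g → Admissible a b →
  (∀ x → mem (proj₁ s) x ≡ kunzMem a b x) → ∃ λ i → enumerate g i ≋ s
enumerated g {a} {b} s a+b≡g adm agree = i , λ x → begin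
  kunzMem (lookup (candidates g) i) (g ∸ lookup (candidates g) i) x
    ≡⟨ cong (λ c → kunzMem c (g ∸ c) x) (lookup-index a∈) ⟨
  kunzMem a (g ∸ a) x   ≡⟨ cong (λ c → kunzMem a c x) g∸a≡b ⟩
  kunzMem a b x         ≡⟨ agree x ⟨
  mem (proj₁ s) x       ∎
  where
  open ≡-Reasoning
  a∈ : a ∈ candidates g
  a∈ = candidate⁺ a+b≡g adm

  i : Fin (length (candidates g))
  i = Any.index a∈

  g∸a≡b : g ∸ a ≡ b
  g∸a≡b = subst (λ n → n ∸ a ≡ b) a+b≡g (m+n∸m≡n a b)

count : ∀ g → HasCard 3 g (length (candidates g))
count g = enumerate g , injective , surjective
  where
  -- equal Kunz semigroups have equal thresholds for the class of 1
  injective : ∀ i j → enumerate g i ≋ enumerate g j → i ≡ j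
  injective i j same = unique-lookup-injective (candidates-unique g) i j
    (threshold-unique λ q → begin
      aᵢ ≤ᵇ q                          ≡⟨ kunz₁ aᵢ (g ∸ aᵢ) q ⟨
      kunzMem aᵢ (g ∸ aᵢ) (1 + q * 3)  ≡⟨ same (1 + q * 3) ⟩
      kunzMem aⱼ (g ∸ aⱼ) (1 + q * 3)  ≡⟨ kunz₁ aⱼ (g ∸ aⱼ) q ⟩
      aⱼ ≤ᵇ q                          ∎)
    where
    open ≡-Reasoning
    aᵢ aⱼ : ℕ
    aᵢ = lookup (candidates g) i
    aⱼ = lookup (candidates g) j

  surjective : ∀ s → ∃ λ i → enumerate g i ≋ s
  surjective s =
    let (_ , _ , a+b≡g , adm , agree) = classify s in enumerated g s a+b≡g adm agree

raise-a : ∀ {a b} → Admissible a b → a ≢ suc (b + b) → Admissible (suc a) b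
raise-a {a} (_ , b≥1 , b≤2a , a≤2b+1) a≢2b+1 =
  s≤s z≤n , b≥1 , ≤-trans b≤2a (+-mono-≤ (n≤1+n a) (n≤1+n a)) , ≤∧≢⇒< a≤2b+1 a≢2b+1

raise-b : ∀ {a b} → Admissible a b → b ≢ a + a → Admissible a (suc b)
raise-b {b = b} (a≥1 , _ , b≤2a , a≤2b+1) b≢2a =
  a≥1 , s≤s z≤n , ≤∧≢⇒< b≤2a b≢2a , ≤-trans a≤2b+1 (s≤s (+-mono-≤ (n≤1+n b) (n≤1+n b)))

boundary-a : ∀ a b → a ≡ suc (b + b) → (a + b) % 3 ≡ 1
boundary-a a b refl = trans (cong (_% 3) (genus-eq b)) (residue 1 b)
  where
  genus-eq : ∀ b → suc (b + b) + b ≡ 1 + b * 3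
  genus-eq = solve-∀

boundary-b : ∀ a b → b ≡ a + a → (a + b) % 3 ≡ 0
boundary-b a b refl = trans (cong (_% 3) (genus-eq a)) (m*n%n≡0 a 3)
  where
  genus-eq : ∀ a → a + (a + a) ≡ a * 3
  genus-eq = solve-∀

-- From genus g to g + 1: raise a when 3 ∣ g, and b otherwise.
raise : ℕ → ℕ → ℕ
raise g a with g % 3
... | zero  = suc a
... | suc _ = a

raise-injective : ∀ g {a a′} → raise g a ≡ raise g a′ → a ≡ a′
raise-injective g e with g % 3
... | zero  = suc-injective e
... | suc _ = e

raise-candidate : ∀ {g a} → a ∈ candidates g → raise g a ∈ candidates (suc g)
raise-candidate {g} {a} a∈ with candidate⁻ a∈ | g % 3 in g%3
... | a+b≡g , adm | zero = candidate⁺ (cong suc a+b≡g) (raise-a adm off-boundary)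
  where
  -- on the boundary a = 2b + 1 the genus would be 1 modulo 3
  off-boundary : a ≢ suc ((g ∸ a) + (g ∸ a))
  off-boundary e =
    0≢1+n (trans (sym g%3) (subst (λ n → n % 3 ≡ 1) a+b≡g (boundary-a a (g ∸ a) e)))
... | a+b≡g , adm | suc _ =
  candidate⁺ (trans (+-suc a (g ∸ a)) (cong suc a+b≡g)) (raise-b adm off-boundary)
  where
  -- on the boundary b = 2a the genus would be 0 modulo 3
  off-boundary : g ∸ a ≢ a + a
  off-boundary e =
    1+n≢0 (trans (sym g%3) (subst (λ n → n % 3 ≡ 0) a+b≡g (boundary-b a (g ∸ a) e)))

candidates-mono : ∀ g → length (candidates g) ≤ length (candidates (suc g))
candidates-mono g = begin
  length (candidates g)                  ≡⟨ length-map (raise g) (candidates g) ⟨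
  length (map (raise g) (candidates g))  ≤⟨ unique-⊆-length raised-unique raised⊆ ⟩
  length (candidates (suc g))            ∎
  where
  open ≤-Reasoning
  raised-unique : Unique (map (raise g) (candidates g))
  raised-unique = Unique.map⁺ (raise-injective g) (candidates-unique g)

  raised⊆ : map (raise g) (candidates g) ⊆ candidates (suc g)
  raised⊆ x∈ with ∈-map⁻ (raise g) x∈
  ... | a , a∈ , refl = raise-candidate {g} a∈

corollary2p4 : ∀ (g : ℕ) → ∃₂ λ (n n′ : ℕ) →
    HasCard 3 g n × HasCard 3 (suc g) n′ × n ≤ n′
corollary2p4 g =
  length (candidates g) , length (candidates (suc g)) , count g , count (suc g) , candidates-mono g
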